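{- Let $\Delta\subseteq{\sim}\mathrm{FO}$ and $\alpha\in\mathrm{FO}$. If $\Delta\models\alpha$, then there is an $\mathrm{FO}$ sentence $\varepsilon$ such that $\Delta\models\varepsilon$ and $\varepsilon\models\alpha$.
   Context: $\mathrm{FO}$: first-order formulas over a countable vocabulary $\tau$ (with $\neg,\to,\forall$ and equality); sentences are formulas without free variables. ${\sim}\mathrm{FO}=\{\sim\delta:\delta\in\mathrm{FO}\}$. Team semantics: valuations $(\mathcal{A},T)$, $\mathcal{A}$ a $\tau$-structure with nonempty domain $A$, $T$ a set of assignments $\mathrm{Var}\to A$; $(\mathcal{A},T)\models\beta$ ($\beta\in\mathrm{FO}$) iff every $s\in T$ satisfies $\beta$ classically; $(\mathcal{A},T)\models\sim\delta$ iff $(\mathcal{A},T)\not\models\delta$. $\Phi\models\psi$ means every valuation satisfying all of $\Phi$ satisfies $\psi$ (in team semantics). -}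

module Defs where

open import Data.Nat using (ℕ; _≟_)
open import Data.Vec using (Vec; []; _∷_)
open import Data.Product using (Σ; _×_; _,_)
open import Data.Sum using (_⊎_)
open import Data.Empty using (⊥)
open import Relation.Nullary using (¬_; yes; no)
open import Relation.Binary.PropositionalEquality using (_≡_)
open import Function.Definitions using (Injective)
open import Level using (Level; suc; zero)

-- Vocabularies (countable: symbol sets inject into ℕ)

record Vocabulary : Set₁ where
  field
    FunSym   : Set            -- function symbols (constants = arity 0)
    RelSym   : Set
    funArity : FunSym → ℕ
    relArity : RelSym → ℕ
    funCode  : FunSym → ℕ
    relCode  : RelSym → ℕ
    funCode-inj : Injective _≡_ _≡_ funCode
    relCode-inj : Injective _≡_ _≡_ relCode

Var : Set
Var = ℕ

module _ (τ : Vocabulary) where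
  open Vocabulary τ

  data Term : Set where
    var  : Var → Term
    func : (f : FunSym) → Vec Term (funArity f) → Term

  data FO : Set where
    _≐_  : Term → Term → FO
    rel  : (R : RelSym) → Vec Term (relArity R) → FO
    ¬ᶠ_  : FO → FO
    _⇒_  : FO → FO → FO
    ∀ᶠ   : Var → FO → FO

  mutual
    data OccursIn (x : Var) : Term → Set where
      occ-var  : OccursIn x (var x)
      occ-func : ∀ {f ts} → OccursInVec x ts → OccursIn x (func f ts)

    data OccursInVec (x : Var) : ∀ {n} → Vec Term n → Set where
      here  : ∀ {n t} {ts : Vec Term n} → OccursIn x t → OccursInVec x (t ∷ ts)
      there : ∀ {n t} {ts : Vec Term n} → OccursInVec x ts → OccursInVec x (t ∷ ts)

  data FreeIn (x : Var) : FO → Set where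
    free-≐ˡ  : ∀ {t u} → OccursIn x t → FreeIn x (t ≐ u)
    free-≐ʳ  : ∀ {t u} → OccursIn x u → FreeIn x (t ≐ u)
    free-rel : ∀ {R ts} → OccursInVec x ts → FreeIn x (rel R ts)
    free-¬   : ∀ {φ} → FreeIn x φ → FreeIn x (¬ᶠ φ)
    free-⇒ˡ  : ∀ {φ ψ} → FreeIn x φ → FreeIn x (φ ⇒ ψ)
    free-⇒ʳ  : ∀ {φ ψ} → FreeIn x ψ → FreeIn x (φ ⇒ ψ)
    free-∀   : ∀ {y φ} → ¬ (x ≡ y) → FreeIn x φ → FreeIn x (∀ᶠ y φ)

  Sentence : FO → Set
  Sentence φ = ∀ x → ¬ FreeIn x φ

  record Structure : Set₁ where
    field
      Dom     : Set
      inhabit : Dom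
      funI    : (f : FunSym) → Vec Dom (funArity f) → Dom
      relI    : (R : RelSym) → Vec Dom (relArity R) → Set

  module _ (𝒜 : Structure) where
    open Structure 𝒜

    Assignment : Set
    Assignment = Var → Dom

    _[_↦_] : Assignment → Var → Dom → Assignment
    (s [ x ↦ a ]) y with y ≟ x
    ... | yes _ = a
    ... | no  _ = s y

    mutual
      evalT : Assignment → Term → Dom
      evalT s (var x)     = s x
      evalT s (func f ts) = funI f (evalTs s ts)

      evalTs : ∀ {n} → Assignment → Vec Term n → Vec Dom n
      evalTs s []       = []
      evalTs s (t ∷ ts) = evalT s t ∷ evalTs s ts

    _⊨₁_ : Assignment → FO → Set
    s ⊨₁ (t ≐ u)    = evalT s t ≡ evalT s u
    s ⊨₁ rel R ts   = relI R (evalTs s ts)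
    s ⊨₁ (¬ᶠ φ)     = ¬ (s ⊨₁ φ)
    s ⊨₁ (φ ⇒ ψ)    = s ⊨₁ φ → s ⊨₁ ψ
    s ⊨₁ ∀ᶠ x φ     = ∀ a → (s [ x ↦ a ]) ⊨₁ φ

    Team : Set₁
    Team = Assignment → Set

  data TFormula : Set where
    fo : FO → TFormula
    ∼_ : FO → TFormula

  _,_⊨ₜ_ : (𝒜 : Structure) → Team 𝒜 → TFormula → Set
  𝒜 , T ⊨ₜ fo β = ∀ s → T s → _⊨₁_ 𝒜 s β
  𝒜 , T ⊨ₜ (∼ δ) = ¬ (𝒜 , T ⊨ₜ fo δ)

  _⊨_ : (TFormula → Set) → TFormula → Set₁
  Φ ⊨ ψ = (𝒜 : Structure) (T : Team 𝒜) →
          (∀ φ → Φ φ → 𝒜 , T ⊨ₜ φ) → 𝒜 , T ⊨ₜ ψ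

  ⟦_⟧ : TFormula → TFormula → Set
  ⟦ φ ⟧ ψ = ψ ≡ φ

  In∼FO : TFormula → Set
  In∼FO ψ = Σ FO λ δ → ψ ≡ (∼ δ)

module Submission where

-- Take ε to be the universal closure ∀x₁…∀xₙ α of α, where the
-- xᵢ list every variable of α; it is a sentence.
--   * ε ⊨ α: a team satisfying ε satisfies α pointwise, since the closure
--     classically implies its matrix at every assignment.
--   * Δ ⊨ ε: formulas ∼δ are upward closed (if a team falsifies δ, so does
--     every larger team).  Hence whenever (𝒜,T) satisfies Δ ⊆ ∼FO, so does
--     (𝒜, all assignments); by Δ ⊨ α, α then holds at every assignment of 𝒜,
--     and thus its closure holds everywhere, in particular on T.

open import Defs
open import Data.Product using (Σ; _×_; _,_)
open import Data.Nat using (_≟_)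
open import Data.Vec using (Vec; []; _∷_)
open import Data.List using (List; []; _∷_; _++_)
open import Data.List.Membership.Propositional using (_∈_)
open import Data.List.Membership.Propositional.Properties using (∈-++⁺ˡ; ∈-++⁺ʳ)
open import Data.List.Relation.Unary.Any using (here; there)
open import Data.Unit using (⊤; tt)
open import Relation.Nullary using (¬_; yes; no)
open import Relation.Binary.PropositionalEquality
  using (_≡_; refl; sym; trans; cong; cong₂; subst)

module _ (τ : Vocabulary) where

  mutual
    varsT : Term τ → List Var
    varsT (var x)     = x ∷ []
    varsT (func f ts) = varsTs ts

    varsTs : ∀ {n} → Vec (Term τ) n → List Var
    varsTs []       = []
    varsTs (t ∷ ts) = varsT t ++ varsTs ts

  vars : FO τ → List Var
  vars (t ≐ u)    = varsT t ++ varsT u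
  vars (rel R ts) = varsTs ts
  vars (¬ᶠ φ)     = vars φ
  vars (φ ⇒ ψ)    = vars φ ++ vars ψ
  vars (∀ᶠ y φ)   = vars φ

  mutual
    occurs⇒∈varsT : ∀ {x t} → OccursIn τ x t → x ∈ varsT t
    occurs⇒∈varsT occ-var      = here refl
    occurs⇒∈varsT (occ-func o) = occurs⇒∈varsTs o

    occurs⇒∈varsTs : ∀ {x n} {ts : Vec (Term τ) n} →
                     OccursInVec τ x ts → x ∈ varsTs ts
    occurs⇒∈varsTs (here o)                = ∈-++⁺ˡ (occurs⇒∈varsT o)
    occurs⇒∈varsTs {ts = t ∷ _} (there o) = ∈-++⁺ʳ (varsT t) (occurs⇒∈varsTs o)

  free⇒∈vars : ∀ {x φ} → FreeIn τ x φ → x ∈ vars φ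
  free⇒∈vars (free-≐ˡ o)               = ∈-++⁺ˡ (occurs⇒∈varsT o)
  free⇒∈vars {φ = t ≐ _} (free-≐ʳ o)   = ∈-++⁺ʳ (varsT t) (occurs⇒∈varsT o)
  free⇒∈vars (free-rel o)              = occurs⇒∈varsTs o
  free⇒∈vars (free-¬ f)                = free⇒∈vars f
  free⇒∈vars (free-⇒ˡ f)               = ∈-++⁺ˡ (free⇒∈vars f)
  free⇒∈vars {φ = φ ⇒ _} (free-⇒ʳ f)   = ∈-++⁺ʳ (vars φ) (free⇒∈vars f)
  free⇒∈vars (free-∀ _ f)              = free⇒∈vars f

  closeOver : List Var → FO τ → FO τ
  closeOver []       α = α
  closeOver (y ∷ ys) α = ∀ᶠ y (closeOver ys α)

  free-closeOver : ∀ {x} ys α → FreeIn τ x (closeOver ys α) →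
                   FreeIn τ x α × ¬ (x ∈ ys)
  free-closeOver []       α f = f , λ ()
  free-closeOver (y ∷ ys) α (free-∀ x≢y f) with free-closeOver ys α f
  ... | fα , x∉ys = fα , λ { (here x≡y) → x≢y x≡y ; (there x∈ys) → x∉ys x∈ys }

  closure : FO τ → FO τ
  closure α = closeOver (vars α) α

  closure-sentence : ∀ α → Sentence τ (closure α)
  closure-sentence α x f with free-closeOver (vars α) α f
  ... | fα , x∉vars = x∉vars (free⇒∈vars fα)

  module Classical (𝒜 : Structure τ) where
    open Structure 𝒜

    _≈_ : Assignment τ 𝒜 → Assignment τ 𝒜 → Set
    s ≈ s' = ∀ y → s y ≡ s' y

    ≈-sym : ∀ {s s'} → s ≈ s' → s' ≈ s
    ≈-sym e y = sym (e y)

    update-cong : ∀ {s s'} → s ≈ s' → ∀ x a →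
                  _[_↦_] τ 𝒜 s x a ≈ _[_↦_] τ 𝒜 s' x a
    update-cong e x a y with y ≟ x
    ... | yes _ = refl
    ... | no  _ = e y

    update-self : ∀ s x → _[_↦_] τ 𝒜 s x (s x) ≈ s
    update-self s x y with y ≟ x
    ... | yes y≡x = cong s (sym y≡x)
    ... | no  _   = refl

    mutual
      evalT-cong : ∀ {s s'} → s ≈ s' → ∀ t → evalT τ 𝒜 s t ≡ evalT τ 𝒜 s' t
      evalT-cong e (var x)     = e x
      evalT-cong e (func f ts) = cong (funI f) (evalTs-cong e ts)

      evalTs-cong : ∀ {s s'} → s ≈ s' → ∀ {n} (ts : Vec (Term τ) n) →
                    evalTs τ 𝒜 s ts ≡ evalTs τ 𝒜 s' ts
      evalTs-cong e []       = refl
      evalTs-cong e (t ∷ ts) = cong₂ _∷_ (evalT-cong e t) (evalTs-cong e ts)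

    ⊨₁-cong : ∀ φ {s s'} → s ≈ s' → _⊨₁_ τ 𝒜 s φ → _⊨₁_ τ 𝒜 s' φ
    ⊨₁-cong (t ≐ u)    e h = trans (sym (evalT-cong e t)) (trans h (evalT-cong e u))
    ⊨₁-cong (rel R ts) e h = subst (relI R) (evalTs-cong e ts) h
    ⊨₁-cong (¬ᶠ φ)     e h = λ h' → h (⊨₁-cong φ (≈-sym e) h')
    ⊨₁-cong (φ ⇒ ψ)    e h = λ h' → ⊨₁-cong ψ e (h (⊨₁-cong φ (≈-sym e) h'))
    ⊨₁-cong (∀ᶠ x φ)   e h = λ a → ⊨₁-cong φ (update-cong e x a) (h a)

    -- ∀ȳ α implies α at every assignment (instantiate each yᵢ by s yᵢ).
    closeOver-elim : ∀ ys α s → _⊨₁_ τ 𝒜 s (closeOver ys α) → _⊨₁_ τ 𝒜 s α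
    closeOver-elim []       α s h = h
    closeOver-elim (y ∷ ys) α s h =
      ⊨₁-cong α (update-self s y)
        (closeOver-elim ys α (_[_↦_] τ 𝒜 s y (s y)) (h (s y)))

    closeOver-intro : ∀ ys α → (∀ s → _⊨₁_ τ 𝒜 s α) →
                      ∀ s → _⊨₁_ τ 𝒜 s (closeOver ys α)
    closeOver-intro []       α valid s = valid s
    closeOver-intro (y ∷ ys) α valid s = λ a → closeOver-intro ys α valid _

  ∼FO-upward : ∀ {𝒜 : Structure τ} {T T' : Team τ 𝒜} {φ} → In∼FO τ φ →
               (∀ s → T s → T' s) → _,_⊨ₜ_ τ 𝒜 T φ → _,_⊨ₜ_ τ 𝒜 T' φ
  ∼FO-upward (δ , refl) T⊆T' T⊭δ T'⊨δ = T⊭δ (λ s Ts → T'⊨δ s (T⊆T' s Ts))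

  fullTeam : (𝒜 : Structure τ) → Team τ 𝒜
  fullTeam 𝒜 _ = ⊤

  full-satisfies : ∀ {Δ : TFormula τ → Set} → (∀ φ → Δ φ → In∼FO τ φ) →
                   ∀ {𝒜} {T : Team τ 𝒜} → (∀ φ → Δ φ → _,_⊨ₜ_ τ 𝒜 T φ) →
                   ∀ φ → Δ φ → _,_⊨ₜ_ τ 𝒜 (fullTeam 𝒜) φ
  full-satisfies Δ⊆∼FO T⊨Δ φ φ∈Δ = ∼FO-upward (Δ⊆∼FO φ φ∈Δ) (λ _ _ → tt) (T⊨Δ φ φ∈Δ)

theorem63 : (τ : Vocabulary) (Δ : TFormula τ → Set) (α : FO τ) →
    (∀ φ → Δ φ → In∼FO τ φ) →
    _⊨_ τ Δ (fo α) →
    Σ (FO τ) λ ε → Sentence τ ε × _⊨_ τ Δ (fo ε) × _⊨_ τ (⟦_⟧ τ (fo ε)) (fo α)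
theorem63 τ Δ α Δ⊆∼FO Δ⊨α =
  closure τ α , closure-sentence τ α , Δ⊨closure , closure⊨α
  where
    -- α holds everywhere on the full team, hence its closure holds on T.
    Δ⊨closure : _⊨_ τ Δ (fo (closure τ α))
    Δ⊨closure 𝒜 T T⊨Δ s _ =
      Classical.closeOver-intro τ 𝒜 (vars τ α) α
        (λ s' → Δ⊨α 𝒜 (fullTeam τ 𝒜) (full-satisfies τ Δ⊆∼FO T⊨Δ) s' tt) s

    closure⊨α : _⊨_ τ (⟦_⟧ τ (fo (closure τ α))) (fo α)
    closure⊨α 𝒜 T T⊨ε s Ts =
      Classical.closeOver-elim τ 𝒜 (vars τ α) α s (T⊨ε _ refl s Ts)
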